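{- Let $k\ge2$. The linear operators $\Psi_k\colon T_k\to W_{k-1}$ and $\Psi_k\circ\Phi_k\colon T_k\to W_{k-1}$ are surjective. Moreover, for every $X=(x_{ij},y_{ij},z_{ij})\in W_{k-1}$, the preimage $(\Psi_k\circ\Phi_k)^{ -1}(X)$ is exactly the set $\{A_{st}: s,t\in\mathbb{R}\}$, where $A_{st}=(a_{ij})\in T_k$ is given by $a_{0j}=s+\sum_{l=j}^{k-1}(x_{1l}+y_{1l})$ for $1\le j<k$, $a_{0k}=s$; $a_{ij}=y_{i\,j-1}$ for $1\le i<j\le k$; $a_{jj}=t+\sum_{l=j}^{k-1}z_{ll}$ for $1\le j<k$, $a_{kk}=t$.
   Context: $T_k$ is the vector space of arrays $(a_{ij})_{0\le i\le j\le k}$ of reals with $a_{00}=0$. For $m\ge1$, $W_m$ is the space of real labelings $(x_{ij},y_{ij},z_{ij})_{1\le i\le j\le m}$ satisfying, for all $1\le i\le j<m$: (BZ1) $y_{ij}+z_{ij}=y_{i+1\,j+1}+z_{i\,j+1}$; (BZ2) $x_{i\,j+1}+y_{ij}=x_{i+1\,j+1}+y_{i+1\,j+1}$; (BZ3) $x_{i\,j+1}+z_{i\,j+1}=x_{i+1\,j+1}+z_{ij}$. $\Phi_k\colon T_k\to T_k$ is $\Phi_k((a_{ij}))=(h_{ij})$ with $h_{ij}=\sum_{p=0}^{i}\sum_{q=p}^{j}a_{pq}$. $\Psi_k\colon T_k\to W_{k-1}$ is $\Psi_k((h_{ij}))=(x_{ij},y_{ij},z_{ij})_{1\le i\le j\le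 k-1}$ with $x_{ij}=h_{ij}+h_{i-1\,j}-h_{i-1\,j-1}-h_{i\,j+1}$, $y_{ij}=h_{i-1\,j}+h_{i\,j+1}-h_{ij}-h_{i-1\,j+1}$, $z_{ij}=h_{ij}+h_{i\,j+1}-h_{i-1\,j}-h_{i+1\,j+1}$. Equivalently $\Psi_k\circ\Phi_k((a_{ij}))$ has $x_{ij}=\sum_{p=0}^{i-1}a_{pj}-\sum_{p=0}^{i}a_{p\,j+1}$, $y_{ij}=a_{i\,j+1}$, $z_{ij}=\sum_{q=i}^{j}a_{iq}-\sum_{q=i+1}^{j+1}a_{i+1\,q}$. -}

module Defs where

open import Level using (Level)
open import Algebra.Bundles using (CommutativeRing)
open import Data.Nat as ℕ using (ℕ; zero; suc; _∸_; _<?_; _≟_)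
open import Data.Product using (_×_)
open import Data.Bool using (if_then_else_)
open import Relation.Nullary using (does)

-- All definitions are over an arbitrary commutative ring R (the paper uses ℝ).
module _ {c ℓ : Level} (R : CommutativeRing c ℓ) where
  open CommutativeRing R

  _−_ : Carrier → Carrier → Carrier
  a − b = a + (- b)

  sumFrom : ℕ → ℕ → (ℕ → Carrier) → Carrier
  sumFrom lo zero    f = 0#
  sumFrom lo (suc n) f = f lo + sumFrom (suc lo) n f

  -- sumRange lo hi f = Σ_{l=lo}^{hi} f l  (empty, i.e. 0, if hi < lo)
  sumRange : ℕ → ℕ → (ℕ → Carrier) → Carrier
  sumRange lo hi f = sumFrom lo (suc hi ∸ lo) f

  -- Triangular arrays are represented by functions ℕ → ℕ → R;
  -- only the entries with 0 ≤ i ≤ j ≤ k are meaningful.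
  Arr : Set c
  Arr = ℕ → ℕ → Carrier

  InT : Arr → Set ℓ
  InT a = a 0 0 ≈ 0#

  EqT : ℕ → Arr → Arr → Set ℓ
  EqT k a b = ∀ i j → i ℕ.≤ j → j ℕ.≤ k → a i j ≈ b i j

  -- labelings (x_ij, y_ij, z_ij); only 1 ≤ i ≤ j ≤ m meaningful
  record Lab : Set c where
    constructor lab
    field
      x y z : Arr
  open Lab public

  -- membership in W_m : the relations BZ1–BZ3 for 1 ≤ i ≤ j < m
  InW : ℕ → Lab → Set ℓ
  InW m X = ∀ i j → 1 ℕ.≤ i → i ℕ.≤ j → j ℕ.< m →
      (y X i j + z X i j ≈ y X (suc i) (suc j) + z X i (suc j))
    × (x X i (suc j) + y X i j ≈ x X (suc i) (suc j) + y X (suc i) (suc j))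
    × (x X i (suc j) + z X i (suc j) ≈ x X (suc i) (suc j) + z X i j)

  EqW : ℕ → Lab → Lab → Set ℓ
  EqW m X Y = ∀ i j → 1 ℕ.≤ i → i ℕ.≤ j → j ℕ.≤ m →
    (x X i j ≈ x Y i j) × (y X i j ≈ y Y i j) × (z X i j ≈ z Y i j)

  Φ : Arr → Arr
  Φ a i j = sumRange 0 i (λ p → sumRange p j (λ q → a p q))

  -- Ψ_k (the formulas are used only for 1 ≤ i ≤ j ≤ k-1)
  Ψ : Arr → Lab
  Ψ h = lab
    (λ i j → ((h i j + h (i ∸ 1) j) − h (i ∸ 1) (j ∸ 1)) − h i (suc j))
    (λ i j → ((h (i ∸ 1) j + h i (suc j)) − h i j) − h (i ∸ 1) (suc j))
    (λ i j → ((h i j + h i (suc j)) − h (i ∸ 1) j) − h (suc i) (suc j))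

  Ast : ℕ → Lab → Carrier → Carrier → Arr
  Ast k X s t zero zero = 0#
  Ast k X s t zero j@(suc _) =
    if does (j <? k)
    then s + sumRange j (k ∸ 1) (λ l → x X 1 l + y X 1 l)
    else s
  Ast k X s t i@(suc _) j =
    if does (i <? j)
    then y X i (j ∸ 1)
    else (if does (i ≟ j)
          then (if does (j <? k) then t + sumRange j (k ∸ 1) (λ l → z X l l) else t)
          else 0#)

{-# OPTIONS --safe #-}
-- With col(i,j) = Σ_{p=0}^{i} a_pj and row(i,j) = Σ_{q=i}^{j} a_iq, the formulas for Ψ∘Φ
-- read x_ij = col(i-1,j) - col(i,j+1), y_ij = a_{i,j+1}, z_ij = row(i,j) - row(i+1,j+1).
-- Hence Ψ(Φ a) = X forces a_ij = y_{i,j-1} above the diagonal, a_0j - a_{0,j+1} = x_1j + y_1j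
-- on row 0 and a_jj - a_{j+1,j+1} = z_jj on the diagonal; these recurrences telescope to
-- the closed forms of A_st with s = a_0k and t = a_kk.  Conversely, for a = A_st the
-- equations for x_1j and z_jj hold by construction, and moving from x_{i,j+1} to
-- x_{i+1,j+1}, or from z_ij to z_{i,j+1}, changes the value computed from a by
-- a_{i,j+1} - a_{i+1,j+2} = y_ij - y_{i+1,j+1}, which is the change prescribed by BZ2,
-- respectively BZ1.  Surjectivity follows by taking A_00.
module Submission where

open import Defs
open import Algebra.Bundles using (CommutativeRing)
open import Data.Nat as ℕ using (ℕ; zero; suc; _≤_; _<_; _∸_; z≤n; s≤s; _<?_; _≟_)
open import Data.Nat.Properties
  using (≤-refl; ≤-trans; ≤-pred; <⇒≤; n≮n; m≤n⇒m≤1+n; m<n⇒m<1+n; m≤n⇒m<n∨m≡n; m≤m+n;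
         +-suc; n∸n≡0; +-∸-assoc; m+[n∸m]≡n)
open import Data.Product using (Σ; _×_; _,_; proj₁; proj₂)
open import Data.Sum using (inj₁; inj₂)
open import Function.Bundles using (_⇔_; mk⇔)
open import Level using (Level)
open import Relation.Nullary.Decidable using (dec-true; dec-false)
import Relation.Binary.PropositionalEquality as ≡

module _ {c ℓ : Level} (R : CommutativeRing c ℓ) where
  open CommutativeRing R
  open import Relation.Binary.Reasoning.Setoid setoid
  open import Algebra.Properties.AbelianGroup +-abelianGroup
    using (//-rightDividesˡ; //-rightDividesʳ; ⁻¹-∙-comm)
  open import Algebra.Properties.CommutativeSemigroup +-commutativeSemigroup
    using (interchange; x∙yz≈y∙xz; x∙yz≈xz∙y; xy∙z≈x∙zy)

  x+y-y≈x : ∀ x y → (x + y) - y ≈ x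
  x+y-y≈x x y = //-rightDividesʳ y x

  x+y-x≈y : ∀ x y → (x + y) - x ≈ y
  x+y-x≈y x y = trans (+-congʳ (+-comm x y)) (x+y-y≈x y x)

  x+y-[z+w]≈[x-z]+[y-w] : ∀ x y z w → (x + y) - (z + w) ≈ (x - z) + (y - w)
  x+y-[z+w]≈[x-z]+[y-w] x y z w =
    trans (+-congˡ (sym (⁻¹-∙-comm z w))) (interchange x y (- z) (- w))

  x+y-[x+z]≈y-z : ∀ x y z → (x + y) - (x + z) ≈ y - z
  x+y-[x+z]≈y-z x y z = begin
    (x + y) - (x + z)  ≈⟨ x+y-[z+w]≈[x-z]+[y-w] x y x z ⟩
    (x - x) + (y - z)  ≈⟨ +-congʳ (-‿inverseʳ x) ⟩
    0# + (y - z)       ≈⟨ +-identityˡ (y - z) ⟩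
    y - z              ∎

  x-[y+z]+z≈x-y : ∀ x y z → (x - (y + z)) + z ≈ x - y
  x-[y+z]+z≈x-y x y z = begin
    (x - (y + z)) + z    ≈⟨ +-assoc x (- (y + z)) z ⟩
    x + (- (y + z) + z)  ≈⟨ +-congˡ (+-congʳ (sym (⁻¹-∙-comm y z))) ⟩
    x + ((- y - z) + z)  ≈⟨ +-congˡ (//-rightDividesˡ z (- y)) ⟩
    x - y                ∎

  x+y≈z+w⇒x+[y-w]≈z : ∀ {x y z w} → x + y ≈ z + w → x + (y - w) ≈ z
  x+y≈z+w⇒x+[y-w]≈z {x} {y} {z} {w} eq = begin
    x + (y - w)  ≈⟨ +-assoc x y (- w) ⟨
    (x + y) - w  ≈⟨ +-congʳ eq ⟩
    (z + w) - w  ≈⟨ x+y-y≈x z w ⟩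
    z            ∎

  x-y≈z⇒x≈y+z : ∀ {x y z} → x - y ≈ z → x ≈ y + z
  x-y≈z⇒x≈y+z {x} {y} {z} eq = begin
    x            ≈⟨ //-rightDividesˡ y x ⟨
    (x - y) + y  ≈⟨ +-comm (x - y) y ⟩
    y + (x - y)  ≈⟨ +-congˡ eq ⟩
    y + z        ∎

  sumFrom-cong : ∀ lo n {f g : ℕ → Carrier} → (∀ p → p < lo ℕ.+ n → f p ≈ g p) →
                 sumFrom R lo n f ≈ sumFrom R lo n g
  sumFrom-cong lo zero    f≈g = refl
  sumFrom-cong lo (suc n) f≈g rewrite +-suc lo n =
    +-cong (f≈g lo (s≤s (m≤m+n lo n))) (sumFrom-cong (suc lo) n f≈g)

  sumFrom-+ : ∀ lo n (f g : ℕ → Carrier) →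
              sumFrom R lo n (λ p → f p + g p) ≈ sumFrom R lo n f + sumFrom R lo n g
  sumFrom-+ lo zero    f g = sym (+-identityʳ 0#)
  sumFrom-+ lo (suc n) f g = trans (+-congˡ (sumFrom-+ (suc lo) n f g)) (interchange _ _ _ _)

  sumFrom-snoc : ∀ lo n (f : ℕ → Carrier) → sumFrom R lo (suc n) f ≈ sumFrom R lo n f + f (lo ℕ.+ n)
  sumFrom-snoc lo zero    f rewrite Data.Nat.Properties.+-identityʳ lo = +-comm (f lo) 0#
  sumFrom-snoc lo (suc n) f rewrite +-suc lo n =
    trans (+-congˡ (sumFrom-snoc (suc lo) n f)) (sym (+-assoc _ _ _))

  sumRange-extendˡ : ∀ {lo hi} (f : ℕ → Carrier) → lo ≤ hi →
                     sumRange R lo hi f ≡.≡ f lo + sumRange R (suc lo) hi f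
  sumRange-extendˡ {lo} f lo≤hi = ≡.cong (λ n → sumFrom R lo n f) (+-∸-assoc 1 lo≤hi)

  sumRange-extendʳ : ∀ {lo hi} (f : ℕ → Carrier) → lo ≤ suc hi →
                     sumRange R lo (suc hi) f ≈ sumRange R lo hi f + f (suc hi)
  sumRange-extendʳ {lo} {hi} f lo≤ = begin
    sumFrom R lo (suc (suc hi) ∸ lo) f              ≡⟨ ≡.cong (λ n → sumFrom R lo n f) (+-∸-assoc 1 lo≤) ⟩
    sumFrom R lo (suc (suc hi ∸ lo)) f              ≈⟨ sumFrom-snoc lo (suc hi ∸ lo) f ⟩
    sumRange R lo hi f + f (lo ℕ.+ (suc hi ∸ lo))   ≡⟨ ≡.cong (λ p → sumRange R lo hi f + f p) (m+[n∸m]≡n lo≤) ⟩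
    sumRange R lo hi f + f (suc hi)                 ∎

  sumRange-empty : ∀ hi (f : ℕ → Carrier) → sumRange R (suc hi) hi f ≈ 0#
  sumRange-empty hi f = reflexive (≡.cong (λ n → sumFrom R (suc hi) n f) (n∸n≡0 hi))

  x+sumRange-empty≈x : ∀ x hi (f : ℕ → Carrier) → x + sumRange R (suc hi) hi f ≈ x
  x+sumRange-empty≈x x hi f = trans (+-congˡ (sumRange-empty hi f)) (+-identityʳ x)

  sumRange-singleton : ∀ l (f : ℕ → Carrier) → sumRange R l l f ≈ f l
  sumRange-singleton l f =
    trans (reflexive (sumRange-extendˡ f ≤-refl)) (x+sumRange-empty≈x (f l) l f)

  recurrence⇒tailSum : ∀ (f d : ℕ → Carrier) m →
    (∀ l → l < m → f l ≈ f (suc l) + d (suc l)) →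
    ∀ j → j ≤ m → f j ≈ f m + sumRange R (suc j) m d
  recurrence⇒tailSum f d m rec j j≤m with m≤n⇒m<n∨m≡n j≤m
  ... | inj₂ ≡.refl = sym (x+sumRange-empty≈x (f j) j d)
  recurrence⇒tailSum f d (suc m) rec j _ | inj₁ (s≤s j≤m) = begin
    f j
      ≈⟨ recurrence⇒tailSum f d m (λ l l<m → rec l (m<n⇒m<1+n l<m)) j j≤m ⟩
    f m + sumRange R (suc j) m d
      ≈⟨ +-congʳ (rec m ≤-refl) ⟩
    (f (suc m) + d (suc m)) + sumRange R (suc j) m d
      ≈⟨ xy∙z≈x∙zy _ _ _ ⟩
    f (suc m) + (sumRange R (suc j) m d + d (suc m))
      ≈⟨ +-congˡ (sumRange-extendʳ d (s≤s j≤m)) ⟨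
    f (suc m) + sumRange R (suc j) (suc m) d ∎

  tailSum⇒recurrence : ∀ (f d : ℕ → Carrier) c m →
    (∀ j → j ≤ m → f j ≈ c + sumRange R (suc j) m d) →
    ∀ l → l < m → f l ≈ f (suc l) + d (suc l)
  tailSum⇒recurrence f d c m closed l l<m = begin
    f l                                               ≈⟨ closed l (<⇒≤ l<m) ⟩
    c + sumRange R (suc l) m d                        ≡⟨ ≡.cong (c +_) (sumRange-extendˡ d l<m) ⟩
    c + (d (suc l) + sumRange R (suc (suc l)) m d)    ≈⟨ x∙yz≈xz∙y _ _ _ ⟩
    (c + sumRange R (suc (suc l)) m d) + d (suc l)    ≈⟨ +-congʳ (closed (suc l) l<m) ⟨
    f (suc l) + d (suc l)                             ∎

  rowSum : Arr R → ℕ → ℕ → Carrier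
  rowSum a p j = sumRange R p j (a p)

  colSum : Arr R → ℕ → ℕ → Carrier
  colSum a i j = sumRange R 0 i (λ p → a p j)

  rowSum-diag : ∀ a p → rowSum a p p ≈ a p p
  rowSum-diag a p = sumRange-singleton p (a p)

  rowSum-suc : ∀ a p j → p ≤ suc j → rowSum a p (suc j) ≈ rowSum a p j + a p (suc j)
  rowSum-suc a p j p≤ = sumRange-extendʳ (a p) p≤

  colSum-zero : ∀ a j → colSum a 0 j ≈ a 0 j
  colSum-zero a j = sumRange-singleton 0 (λ p → a p j)

  colSum-suc : ∀ a i j → colSum a (suc i) j ≈ colSum a i j + a (suc i) j
  colSum-suc a i j = sumRange-extendʳ (λ p → a p j) z≤n

  Φ-sucˡ : ∀ a i j → Φ R a (suc i) j ≈ Φ R a i j + rowSum a (suc i) j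
  Φ-sucˡ a i j = sumRange-extendʳ {hi = i} (λ p → rowSum a p j) z≤n

  Φ-sucʳ : ∀ a i j → i ≤ suc j → Φ R a i (suc j) ≈ Φ R a i j + colSum a i (suc j)
  Φ-sucʳ a i j i≤ = trans
    (sumFrom-cong 0 (suc i) (λ p p<1+i → rowSum-suc a p j (≤-trans (≤-pred p<1+i) i≤)))
    (sumFrom-+ 0 (suc i) (λ p → rowSum a p j) (λ p → a p (suc j)))

  Φ-InT : ∀ a → InT R a → InT R (Φ R a)
  Φ-InT a a₀₀≈0 = trans (sumRange-singleton 0 (λ p → rowSum a p 0)) (trans (rowSum-diag a 0) a₀₀≈0)

  x-ΨΦ : ∀ a i j → i ≤ j →
         x (Ψ R (Φ R a)) (suc i) (suc j) ≈ colSum a i (suc j) - colSum a (suc i) (suc (suc j))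
  x-ΨΦ a i j i≤j = begin
    ((A + Φ R a i (suc j)) - B) - Φ R a (suc i) (suc (suc j))
      ≈⟨ +-cong (+-congʳ (+-congˡ (Φ-sucʳ a i j (m≤n⇒m≤1+n i≤j))))
                (-‿cong (Φ-sucʳ a (suc i) (suc j) (s≤s (m≤n⇒m≤1+n i≤j)))) ⟩
    ((A + (B + c₁)) - B) - (A + c₂)
      ≈⟨ +-congʳ (trans (+-congʳ (x∙yz≈xz∙y A B c₁)) (x+y-y≈x (A + c₁) B)) ⟩
    (A + c₁) - (A + c₂)
      ≈⟨ x+y-[x+z]≈y-z A c₁ c₂ ⟩
    c₁ - c₂ ∎
    where
    A B c₁ c₂ : Carrier
    A = Φ R a (suc i) (suc j)
    B = Φ R a i j
    c₁ = colSum a i (suc j)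
    c₂ = colSum a (suc i) (suc (suc j))

  y-ΨΦ : ∀ a i j → i ≤ j → y (Ψ R (Φ R a)) (suc i) j ≈ a (suc i) (suc j)
  y-ΨΦ a i j i≤j = begin
    ((A + Φ R a (suc i) (suc j)) - Φ R a (suc i) j) - B
      ≈⟨ +-congʳ (+-cong (+-congˡ (trans (Φ-sucˡ a i (suc j)) (+-congˡ (rowSum-suc a (suc i) j (s≤s i≤j)))))
                         (-‿cong (Φ-sucˡ a i j))) ⟩
    ((A + (B + (r + e))) - (A + r)) - B
      ≈⟨ +-congʳ (+-congʳ (trans (+-congˡ (x∙yz≈y∙xz B r e)) (sym (+-assoc A r (B + e))))) ⟩
    (((A + r) + (B + e)) - (A + r)) - B
      ≈⟨ +-congʳ (x+y-x≈y (A + r) (B + e)) ⟩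
    (B + e) - B
      ≈⟨ x+y-x≈y B e ⟩
    e ∎
    where
    A B r e : Carrier
    A = Φ R a i j
    B = Φ R a i (suc j)
    r = rowSum a (suc i) j
    e = a (suc i) (suc j)

  z-ΨΦ : ∀ a i j → z (Ψ R (Φ R a)) (suc i) j ≈ rowSum a (suc i) j - rowSum a (suc (suc i)) (suc j)
  z-ΨΦ a i j = begin
    ((Φ R a (suc i) j + B) - A) - Φ R a (suc (suc i)) (suc j)
      ≈⟨ +-cong (+-congʳ (+-congʳ (Φ-sucˡ a i j))) (-‿cong (Φ-sucˡ a (suc i) (suc j))) ⟩
    (((A + r₁) + B) - A) - (B + r₂)
      ≈⟨ +-congʳ (trans (+-congʳ (xy∙z≈x∙zy A r₁ B)) (x+y-x≈y A (B + r₁))) ⟩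
    (B + r₁) - (B + r₂)
      ≈⟨ x+y-[x+z]≈y-z B r₁ r₂ ⟩
    r₁ - r₂ ∎
    where
    A B r₁ r₂ : Carrier
    A = Φ R a i j
    B = Φ R a (suc i) (suc j)
    r₁ = rowSum a (suc i) j
    r₂ = rowSum a (suc (suc i)) (suc j)

  row₀-ΨΦ : ∀ a l → x (Ψ R (Φ R a)) 1 (suc l) + y (Ψ R (Φ R a)) 1 (suc l) ≈ a 0 (suc l) - a 0 (suc (suc l))
  row₀-ΨΦ a l = begin
    x (Ψ R (Φ R a)) 1 (suc l) + y (Ψ R (Φ R a)) 1 (suc l)
      ≈⟨ +-cong (x-ΨΦ a 0 l z≤n) (y-ΨΦ a 0 (suc l) z≤n) ⟩
    (colSum a 0 (suc l) - colSum a 1 (suc (suc l))) + a 1 (suc (suc l))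
      ≈⟨ +-congʳ (+-cong (colSum-zero a (suc l))
                         (-‿cong (trans (colSum-suc a 0 (suc (suc l))) (+-congʳ (colSum-zero a (suc (suc l))))))) ⟩
    (a 0 (suc l) - (a 0 (suc (suc l)) + a 1 (suc (suc l)))) + a 1 (suc (suc l))
      ≈⟨ x-[y+z]+z≈x-y _ _ _ ⟩
    a 0 (suc l) - a 0 (suc (suc l)) ∎

  diag-ΨΦ : ∀ a l → z (Ψ R (Φ R a)) (suc l) (suc l) ≈ a (suc l) (suc l) - a (suc (suc l)) (suc (suc l))
  diag-ΨΦ a l = trans (z-ΨΦ a l (suc l)) (+-cong (rowSum-diag a (suc l)) (-‿cong (rowSum-diag a (suc (suc l)))))

  Ast-upper : ∀ k X s t i j → suc i < j → Ast R k X s t (suc i) j ≡.≡ y X (suc i) (j ∸ 1)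
  Ast-upper k X s t i j i<j rewrite dec-true (suc i <? j) i<j = ≡.refl

  -- j = m is the paper's a_0k = s, read as an empty sum; likewise for Ast-diag.
  Ast-row₀ : ∀ m X s t j → j ≤ m →
             Ast R (suc m) X s t 0 (suc j) ≈ s + sumRange R (suc j) m (λ l → x X 1 l + y X 1 l)
  Ast-row₀ m X s t j j≤m with m≤n⇒m<n∨m≡n j≤m
  ... | inj₁ j<m rewrite dec-true (suc j <? suc m) (s≤s j<m) = refl
  ... | inj₂ ≡.refl rewrite dec-false (suc j <? suc j) (n≮n (suc j)) = sym (x+sumRange-empty≈x s j _)

  Ast-diag : ∀ m X s t j → j ≤ m →
             Ast R (suc m) X s t (suc j) (suc j) ≈ t + sumRange R (suc j) m (λ l → z X l l)
  Ast-diag m X s t j j≤m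
    rewrite dec-false (suc j <? suc j) (n≮n (suc j)) | dec-true (suc j ≟ suc j) ≡.refl
    with m≤n⇒m<n∨m≡n j≤m
  ... | inj₁ j<m rewrite dec-true (suc j <? suc m) (s≤s j<m) = refl
  ... | inj₂ ≡.refl rewrite dec-false (suc j <? suc j) (n≮n (suc j)) = sym (x+sumRange-empty≈x t j _)

  ΨΦ≈⇒≈Ast : ∀ m X a → InT R a → EqW R m (Ψ R (Φ R a)) X →
             EqT R (suc m) a (Ast R (suc m) X (a 0 (suc m)) (a (suc m) (suc m)))
  ΨΦ≈⇒≈Ast m X a a₀₀≈0 ΨΦa≈X = entry
    where
    s t : Carrier
    s = a 0 (suc m)
    t = a (suc m) (suc m)

    row₀-step : ∀ l → l < m → a 0 (suc l) ≈ a 0 (suc (suc l)) + (x X 1 (suc l) + y X 1 (suc l))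
    row₀-step l l<m with ΨΦa≈X 1 (suc l) (s≤s z≤n) (s≤s z≤n) l<m
    ... | x≈ , y≈ , _ = x-y≈z⇒x≈y+z (trans (sym (row₀-ΨΦ a l)) (+-cong x≈ y≈))

    diag-step : ∀ l → l < m → a (suc l) (suc l) ≈ a (suc (suc l)) (suc (suc l)) + z X (suc l) (suc l)
    diag-step l l<m = x-y≈z⇒x≈y+z
      (trans (sym (diag-ΨΦ a l)) (proj₂ (proj₂ (ΨΦa≈X (suc l) (suc l) (s≤s z≤n) ≤-refl l<m))))

    entry : EqT R (suc m) a (Ast R (suc m) X s t)
    entry zero zero _ _ = a₀₀≈0
    entry zero (suc j) _ (s≤s j≤m) =
      trans (recurrence⇒tailSum (λ l → a 0 (suc l)) _ m row₀-step j j≤m) (sym (Ast-row₀ m X s t j j≤m))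
    entry (suc i) j i≤j _ with m≤n⇒m<n∨m≡n i≤j
    entry (suc i) (suc j) _ (s≤s j≤m) | inj₁ (s≤s i<j) = begin
      a (suc i) (suc j)              ≈⟨ y-ΨΦ a i j (<⇒≤ i<j) ⟨
      y (Ψ R (Φ R a)) (suc i) j      ≈⟨ proj₁ (proj₂ (ΨΦa≈X (suc i) j (s≤s z≤n) i<j j≤m)) ⟩
      y X (suc i) j                  ≡⟨ Ast-upper (suc m) X s t i (suc j) (s≤s i<j) ⟨
      Ast R (suc m) X s t (suc i) (suc j) ∎
    entry (suc i) .(suc i) _ (s≤s i≤m) | inj₂ ≡.refl =
      trans (recurrence⇒tailSum (λ l → a (suc l) (suc l)) _ m diag-step i i≤m) (sym (Ast-diag m X s t i i≤m))

  module _ (m : ℕ) (X : Lab R) (X∈W : InW R m X) (s t : Carrier) (a : Arr R)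
           (a≈A : EqT R (suc m) a (Ast R (suc m) X s t)) where

    private
      upper : ∀ i j → suc i ≤ j → j ≤ m → a (suc i) (suc j) ≈ y X (suc i) j
      upper i j i<j j≤m = trans (a≈A (suc i) (suc j) (m≤n⇒m≤1+n i<j) (s≤s j≤m))
                                (reflexive (Ast-upper (suc m) X s t i (suc j) (s≤s i<j)))

      row₀-step : ∀ l → l < m → a 0 (suc l) ≈ a 0 (suc (suc l)) + (x X 1 (suc l) + y X 1 (suc l))
      row₀-step = tailSum⇒recurrence (λ l → a 0 (suc l)) _ s m
        (λ j j≤m → trans (a≈A 0 (suc j) z≤n (s≤s j≤m)) (Ast-row₀ m X s t j j≤m))

      diag-step : ∀ l → l < m → a (suc l) (suc l) ≈ a (suc (suc l)) (suc (suc l)) + z X (suc l) (suc l)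
      diag-step = tailSum⇒recurrence (λ l → a (suc l) (suc l)) _ t m
        (λ j j≤m → trans (a≈A (suc j) (suc j) ≤-refl (s≤s j≤m)) (Ast-diag m X s t j j≤m))

    colSum-gap : ∀ i j → i ≤ j → j < m →
                 colSum a i (suc j) - colSum a (suc i) (suc (suc j)) ≈ x X (suc i) (suc j)
    colSum-gap zero j _ j<m = begin
      colSum a 0 (suc j) - colSum a 1 (suc (suc j))
        ≈⟨ +-cong (colSum-zero a (suc j))
                  (-‿cong (trans (colSum-suc a 0 (suc (suc j))) (+-congʳ (colSum-zero a (suc (suc j)))))) ⟩
      a 0 (suc j) - (a 0 (suc (suc j)) + a 1 (suc (suc j)))
        ≈⟨ +-cong (row₀-step j j<m) (-‿cong (+-congˡ (upper 0 (suc j) (s≤s z≤n) j<m))) ⟩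
      (a 0 (suc (suc j)) + (x X 1 (suc j) + y X 1 (suc j))) - (a 0 (suc (suc j)) + y X 1 (suc j))
        ≈⟨ x+y-[x+z]≈y-z _ _ _ ⟩
      (x X 1 (suc j) + y X 1 (suc j)) - y X 1 (suc j)
        ≈⟨ x+y-y≈x _ _ ⟩
      x X 1 (suc j) ∎
    colSum-gap (suc i) j i<j j<m = begin
      colSum a (suc i) (suc j) - colSum a (suc (suc i)) (suc (suc j))
        ≈⟨ +-cong (colSum-suc a i (suc j)) (-‿cong (colSum-suc a (suc i) (suc (suc j)))) ⟩
      (colSum a i (suc j) + a (suc i) (suc j)) - (colSum a (suc i) (suc (suc j)) + a (suc (suc i)) (suc (suc j)))
        ≈⟨ x+y-[z+w]≈[x-z]+[y-w] _ _ _ _ ⟩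
      (colSum a i (suc j) - colSum a (suc i) (suc (suc j))) + (a (suc i) (suc j) - a (suc (suc i)) (suc (suc j)))
        ≈⟨ +-cong (colSum-gap i j (<⇒≤ i<j) j<m)
                  (+-cong (upper i j i<j (<⇒≤ j<m)) (-‿cong (upper (suc i) (suc j) (s≤s i<j) j<m))) ⟩
      x X (suc i) (suc j) + (y X (suc i) j - y X (suc (suc i)) (suc j))
        ≈⟨ x+y≈z+w⇒x+[y-w]≈z (proj₁ (proj₂ (X∈W (suc i) j (s≤s z≤n) i<j j<m))) ⟩
      x X (suc (suc i)) (suc j) ∎

    rowSum-gap : ∀ i j → suc i ≤ j → j ≤ m →
                 rowSum a (suc i) j - rowSum a (suc (suc i)) (suc j) ≈ z X (suc i) j
    rowSum-gap i j i<j _ with m≤n⇒m<n∨m≡n i<j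
    rowSum-gap i .(suc i) _ i<m | inj₂ ≡.refl = begin
      rowSum a (suc i) (suc i) - rowSum a (suc (suc i)) (suc (suc i))
        ≈⟨ +-cong (rowSum-diag a (suc i)) (-‿cong (rowSum-diag a (suc (suc i)))) ⟩
      a (suc i) (suc i) - a (suc (suc i)) (suc (suc i))
        ≈⟨ +-congʳ (trans (diag-step i i<m) (+-comm _ _)) ⟩
      (z X (suc i) (suc i) + a (suc (suc i)) (suc (suc i))) - a (suc (suc i)) (suc (suc i))
        ≈⟨ x+y-y≈x _ _ ⟩
      z X (suc i) (suc i) ∎
    rowSum-gap i (suc j) _ j<m | inj₁ (s≤s i<j) = begin
      rowSum a (suc i) (suc j) - rowSum a (suc (suc i)) (suc (suc j))
        ≈⟨ +-cong (rowSum-suc a (suc i) j (m≤n⇒m≤1+n i<j))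
                  (-‿cong (rowSum-suc a (suc (suc i)) (suc j) (s≤s (m≤n⇒m≤1+n i<j)))) ⟩
      (rowSum a (suc i) j + a (suc i) (suc j)) - (rowSum a (suc (suc i)) (suc j) + a (suc (suc i)) (suc (suc j)))
        ≈⟨ x+y-[z+w]≈[x-z]+[y-w] _ _ _ _ ⟩
      (rowSum a (suc i) j - rowSum a (suc (suc i)) (suc j)) + (a (suc i) (suc j) - a (suc (suc i)) (suc (suc j)))
        ≈⟨ +-cong (rowSum-gap i j i<j (<⇒≤ j<m))
                  (+-cong (upper i j i<j (<⇒≤ j<m)) (-‿cong (upper (suc i) (suc j) (s≤s i<j) j<m))) ⟩
      z X (suc i) j + (y X (suc i) j - y X (suc (suc i)) (suc j))
        ≈⟨ x+y≈z+w⇒x+[y-w]≈z (trans (+-comm _ _) (trans (proj₁ (X∈W (suc i) j (s≤s z≤n) i<j j<m)) (+-comm _ _))) ⟩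
      z X (suc i) (suc j) ∎

    ≈Ast⇒ΨΦ≈ : EqW R m (Ψ R (Φ R a)) X
    ≈Ast⇒ΨΦ≈ (suc i) (suc j) (s≤s z≤n) (s≤s i≤j) j<m =
        trans (x-ΨΦ a i j i≤j) (colSum-gap i j i≤j j<m)
      , trans (y-ΨΦ a i (suc j) (m≤n⇒m≤1+n i≤j)) (upper i (suc j) (s≤s i≤j) j<m)
      , trans (z-ΨΦ a i (suc j)) (rowSum-gap i (suc j) (s≤s i≤j) j<m)

lemma6p1 : ∀ {c ℓ} (R : CommutativeRing c ℓ) (k : ℕ) → 2 ≤ k →
    ((X : Lab R) → InW R (k ∸ 1) X →
        Σ (Arr R) (λ h → InT R h × EqW R (k ∸ 1) (Ψ R h) X))
    × ((X : Lab R) → InW R (k ∸ 1) X →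
        Σ (Arr R) (λ a → InT R a × EqW R (k ∸ 1) (Ψ R (Φ R a)) X))
    × ((X : Lab R) → InW R (k ∸ 1) X → (a : Arr R) → InT R a →
        (EqW R (k ∸ 1) (Ψ R (Φ R a)) X
          ⇔ Σ (CommutativeRing.Carrier R) (λ s → Σ (CommutativeRing.Carrier R) (λ t →
               EqT R k a (Ast R k X s t)))))
lemma6p1 R (suc (suc n)) (s≤s (s≤s z≤n)) =
    (λ X X∈W → Φ R (A₀ X) , Φ-InT R (A₀ X) refl , A₀-solves X X∈W)
  , (λ X X∈W → A₀ X , refl , A₀-solves X X∈W)
  , λ X X∈W a a∈T → mk⇔
      (λ ΨΦa≈X → a 0 k , a k k , ΨΦ≈⇒≈Ast R (suc n) X a a∈T ΨΦa≈X)
      (λ (s , t , a≈A) → ≈Ast⇒ΨΦ≈ R (suc n) X X∈W s t a a≈A)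
  where
  open CommutativeRing R using (0#; refl)

  k : ℕ
  k = suc (suc n)

  A₀ : Lab R → Arr R
  A₀ X = Ast R k X 0# 0#

  A₀-solves : ∀ X → InW R (suc n) X → EqW R (suc n) (Ψ R (Φ R (A₀ X))) X
  A₀-solves X X∈W = ≈Ast⇒ΨΦ≈ R (suc n) X X∈W 0# 0# (A₀ X) (λ _ _ _ _ → refl)
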